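{- Let $Q$ be a $2$-complete acyclic quiver, and let $Q'$ be a quiver mutation-equivalent to $Q$. Suppose that $Q_1\subset Q'$ is a (full) subquiver of $Q'$ having a source or a sink. Then $Q_1$ is acyclic.
   Context: Quivers. A quiver here is a finite quiver without loops and $2$-cycles; it is encoded by a skew-symmetric integer matrix $(b_{ij})$, with $b_{ij}$ arrows $i\to j$ when $b_{ij}>0$. It is $2$-complete if $|b_{ij}|\ge2$ for all $i\ne j$. It is acyclic if it has no oriented cycles. Mutation. The mutation $\mu_k$ replaces $(b_{ij})$ by $(b'_{ij})$ with $b'_{ij}=-b_{ij}$ if $i=k$ or $j=k$, and $b'_{ij}=b_{ij}+\frac{|b_{ik}|b_{kj}+b_{ik}|b_{kj}|}{2}$ otherwise. Quivers are mutation-equivalent if one is obtained from the other by a finite sequence of mutations. Subquivers. A (full) subquiver is spanned by a subset of vertices together with all arrows between them. A source (sink) of $Q_1$ is a vertex all of whose arrows in $Q_1$ are outgoing (incoming). -}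

module Defs where

open import Data.Nat using (ℕ)
open import Data.Fin using (Fin; _≟_)
open import Data.Integer using (ℤ; +_; -_; _+_; _*_; _/_; _<_; _≤_; ∣_∣; 0ℤ)
open import Data.List using (List; []; _∷_)
open import Data.Product using (∃-syntax)
open import Data.Sum using (_⊎_)
open import Relation.Binary.PropositionalEquality using (_≡_; _≢_)
open import Relation.Nullary using (¬_; yes; no)
open import Relation.Nullary.Decidable using (⌊_⌋)
open import Data.Bool using (_∨_; if_then_else_)

-- An integer matrix on n vertices; b i j > 0 means b i j arrows i → j.
Matrix : ℕ → Set
Matrix n = Fin n → Fin n → ℤ

-- Quivers without loops and 2-cycles are encoded by skew-symmetric matrices.
SkewSymmetric : ∀ {n} → Matrix n → Set
SkewSymmetric {n} b = ∀ (i j : Fin n) → b i j ≡ - b j i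

TwoComplete : ∀ {n} → Matrix n → Set
TwoComplete {n} b = ∀ (i j : Fin n) → i ≢ j → + 2 ≤ + ∣ b i j ∣

data Path {n : ℕ} (b : Matrix n) : Fin n → Fin n → Set where
  arrow : ∀ {i j} → 0ℤ < b i j → Path b i j
  _◅_   : ∀ {i j k} → 0ℤ < b i j → Path b j k → Path b i k

Acyclic : ∀ {n} → Matrix n → Set
Acyclic {n} b = ∀ (i : Fin n) → ¬ Path b i i

-- Matrix mutation at k (the numerator is always even, so the division is exact).
mutate : ∀ {n} → Fin n → Matrix n → Matrix n
mutate k b i j =
  if ⌊ i ≟ k ⌋ ∨ ⌊ j ≟ k ⌋
  then - b i j
  else b i j + ((+ ∣ b i k ∣) * b k j + b i k * (+ ∣ b k j ∣)) / + 2

mutateSeq : ∀ {n} → List (Fin n) → Matrix n → Matrix n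
mutateSeq []       b = b
mutateSeq (k ∷ ks) b = mutateSeq ks (mutate k b)

MutationEquivalent : ∀ {n} → Matrix n → Matrix n → Set
MutationEquivalent {n} b b' = ∃[ ks ] mutateSeq {n} ks b ≡ b'

-- Full subquiver spanned by the image of an (injective) vertex map f.
restrict : ∀ {m n} → Matrix n → (Fin m → Fin n) → Matrix m
restrict b f i j = b (f i) (f j)

IsSource : ∀ {n} → Matrix n → Fin n → Set
IsSource {n} b v = ∀ (j : Fin n) → 0ℤ ≤ b v j

IsSink : ∀ {n} → Matrix n → Fin n → Set
IsSink {n} b v = ∀ (j : Fin n) → b v j ≤ 0ℤ

HasSourceOrSink : ∀ {n} → Matrix n → Set
HasSourceOrSink {n} b = ∃[ v ] (IsSource {n} b v ⊎ IsSink b v)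

module Submission where

-- A fork with point of return r is a 2-complete quiver in which the full subquivers on the
-- out-neighbours and on the in-neighbours of r are acyclic and every path i → r → j is
-- dominated by the arrows j → i, i.e. b i r < b j i and b r j < b j i.

open import Defs
open import Data.Nat as ℕ using (ℕ; zero; suc)
import Data.Nat.Properties as ℕ
import Data.Nat.DivMod as ℕ
open import Data.Fin using (Fin; _≟_)
open import Data.Integer
  using (ℤ; +_; -[1+_]; 0ℤ; _+_; _*_; -_; _/_; _/ℕ_; ∣_∣; _<_; _≤_; +<+; +≤+; -<+)
open import Data.Integer.Properties
  using ( neg-involutive; neg-cancel-<; neg-mono-<; <-irrefl; <-asym; <-trans; ≤⇒≯; <⇒≤
        ; +-monoʳ-<; +-identityʳ; *-identityˡ; *-zeroʳ; *-comm; pos-*; ∣-i∣≡∣i∣)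
open import Data.Integer.Tactic.RingSolver using (solve-∀)
open import Data.Empty using (⊥-elim)
open import Data.Product using (_×_; _,_; proj₁; proj₂; ∃-syntax)
import Data.Product as Product
open import Data.Sum using (_⊎_; inj₁; inj₂)
import Data.Sum as Sum
import Data.List as List
open import Function using (id; flip)
open import Function.Definitions using (Injective)
open import Relation.Binary.Construct.Closure.Transitive using (TransClosure; [_]; _∷_; _∷ʳ_)
open import Relation.Binary.PropositionalEquality hiding ([_])
open import Relation.Nullary using (¬_; yes; no)
open import Relation.Nullary.Decidable using (toSum)

private
  variable
    n : ℕ
    i j k r x y : Fin n
    b : Matrix n

-- (1) Integer arithmetic

self-negating⇒0 : ∀ z → z ≡ - z → z ≡ 0ℤ
self-negating⇒0 (+ zero)  _ = refl
self-negating⇒0 (+ suc _) ()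
self-negating⇒0 -[1+ _ ]  ()

large⇒pos⊎neg : ∀ z → + 2 ≤ + ∣ z ∣ → 0ℤ < z ⊎ z < 0ℤ
large⇒pos⊎neg (+ zero)  (+≤+ ())
large⇒pos⊎neg (+ suc _) _ = inj₁ (+<+ (ℕ.s≤s ℕ.z≤n))
large⇒pos⊎neg -[1+ _ ]  _ = inj₂ -<+

0<-z⇒z<0 : ∀ {z} → 0ℤ < - z → z < 0ℤ
0<-z⇒z<0 = neg-cancel-< {0ℤ}

z<0⇒0<-z : ∀ {z} → z < 0ℤ → 0ℤ < - z
z<0⇒0<-z = neg-mono-<

-- The correction term sgn(x)[x·y]₊ of matrix mutation: x·y when x, y > 0, −(x·y) when
-- x, y < 0, and 0 when the signs are mixed.
signedProduct : ℤ → ℤ → ℤ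
signedProduct (+ a)    (+ a')    = + a * + a'
signedProduct -[1+ a ] -[1+ a' ] = - (-[1+ a ] * -[1+ a' ])
signedProduct _        _         = 0ℤ

numerator≡double : ∀ x y → + ∣ x ∣ * y + x * + ∣ y ∣ ≡ signedProduct x y + signedProduct x y
numerator≡double (+ a)    (+ a')    = refl
numerator≡double (+ a)    -[1+ a' ] = opposite (+ a) (+ suc a')
  where opposite : ∀ u v → u * (- v) + u * v ≡ 0ℤ + 0ℤ
        opposite = solve-∀
numerator≡double -[1+ a ] (+ a')    = opposite (+ suc a) (+ a')
  where opposite : ∀ u v → u * v + (- u) * v ≡ 0ℤ + 0ℤ
        opposite = solve-∀
numerator≡double -[1+ a ] -[1+ a' ] = negatives (+ suc a) (+ suc a')
  where negatives : ∀ u v → u * (- v) + (- u) * v ≡ - ((- u) * (- v)) + - ((- u) * (- v))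
        negatives = solve-∀

double≡*2 : ∀ m → m ℕ.+ m ≡ m ℕ.* 2
double≡*2 m = trans (cong (m ℕ.+_) (sym (ℕ.+-identityʳ m))) (ℕ.*-comm 2 m)

double-suc : ∀ m → suc (suc (m ℕ.+ m)) ≡ suc m ℕ.* 2
double-suc m = trans (cong suc (sym (ℕ.+-suc m m))) (double≡*2 (suc m))

half-double-negative : ∀ m → -[1+ suc (m ℕ.+ m) ] /ℕ 2 ≡ -[1+ m ]
half-double-negative m with suc (suc (m ℕ.+ m)) ℕ.% 2 in rem
... | zero  = cong (λ q → - (+ q)) (trans (cong (ℕ._/ 2) (double-suc m)) (ℕ.m*n/n≡m (suc m) 2))
... | suc _ with () ← trans (sym rem) (trans (cong (ℕ._% 2) (double-suc m)) (ℕ.m*n%n≡0 (suc m) 2))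

half-double : ∀ z → (z + z) / + 2 ≡ z
half-double (+ m) = begin
  + (m ℕ.+ m) / + 2       ≡⟨ *-identityˡ _ ⟩
  + ((m ℕ.+ m) ℕ./ 2)     ≡⟨ cong (λ t → + (t ℕ./ 2)) (double≡*2 m) ⟩
  + ((m ℕ.* 2) ℕ./ 2)     ≡⟨ cong +_ (ℕ.m*n/n≡m m 2) ⟩
  + m                     ∎
  where open ≡-Reasoning
half-double -[1+ m ] = trans (*-identityˡ _) (half-double-negative m)

mutation-increment : ∀ x y → (+ ∣ x ∣ * y + x * + ∣ y ∣) / + 2 ≡ signedProduct x y
mutation-increment x y = trans (cong (_/ + 2) (numerator≡double x y)) (half-double (signedProduct x y))

signedProduct-pos : ∀ {x y} → 0ℤ < x → 0ℤ < y → signedProduct x y ≡ x * y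
signedProduct-pos (+<+ _) (+<+ _) = refl

signedProduct-mixed : ∀ {x y} → 0ℤ ≤ x → y ≤ 0ℤ → signedProduct x y ≡ 0ℤ
signedProduct-mixed {+ a} {+ .0}      _ (+≤+ ℕ.z≤n) = *-zeroʳ (+ a)
signedProduct-mixed {+ a} { -[1+ _ ]} _ _           = refl

signedProduct-comm : ∀ x y → signedProduct x y ≡ signedProduct y x
signedProduct-comm (+ a)    (+ a')    = *-comm (+ a) (+ a')
signedProduct-comm (+ a)    -[1+ a' ] = refl
signedProduct-comm -[1+ a ] (+ a')    = refl
signedProduct-comm -[1+ a ] -[1+ a' ] = cong -_ (*-comm -[1+ a ] -[1+ a' ])

signedProduct-neg : ∀ x y → signedProduct (- x) (- y) ≡ - signedProduct x y
signedProduct-neg (+ zero)  (+ zero)   = refl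
signedProduct-neg (+ zero)  (+ suc _)  = refl
signedProduct-neg (+ suc a) (+ zero)   = cong -_ (sym (*-zeroʳ (+ suc a)))
signedProduct-neg (+ suc _) (+ suc _)  = refl
signedProduct-neg (+ zero)  -[1+ _ ]   = refl
signedProduct-neg (+ suc _) -[1+ _ ]   = refl
signedProduct-neg -[1+ a ]  (+ zero)   = *-zeroʳ (+ suc a)
signedProduct-neg -[1+ _ ]  (+ suc _)  = refl
signedProduct-neg -[1+ a ]  -[1+ a' ]  = negatives (+ suc a) (+ suc a')
  where negatives : ∀ u v → u * v ≡ - - ((- u) * (- v))
        negatives = solve-∀

<-+* : ∀ {c x y} → 0 ℕ.< c → 0 ℕ.< x → y ℕ.< c ℕ.+ x ℕ.* y
<-+* {c} {suc x} {y} 0<c _ = ℕ.≤-<-trans (ℕ.m≤n*m y (suc x)) (ℕ.m<n+m _ 0<c)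

v+u<w*v : ∀ {u v w} → u ℕ.< v → 2 ℕ.≤ w → v ℕ.+ u ℕ.< w ℕ.* v
v+u<w*v {u} {v} {w} u<v 2≤w = begin-strict
  v ℕ.+ u  <⟨ ℕ.+-monoʳ-< v u<v ⟩
  v ℕ.+ v  ≡⟨ cong (v ℕ.+_) (ℕ.+-identityʳ v) ⟨
  2 ℕ.* v  ≤⟨ ℕ.*-monoˡ-≤ v 2≤w ⟩
  w ℕ.* v  ∎
  where open ℕ.≤-Reasoning

w+u<w*v : ∀ {u v w} → 0 ℕ.< u → u ℕ.< v → 2 ℕ.≤ w → w ℕ.+ u ℕ.< w ℕ.* v
w+u<w*v {u} {v} {w} 0<u u<v 2≤w = begin-strict
  w ℕ.+ u        <⟨ ℕ.+-monoʳ-< w u<w*u ⟩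
  w ℕ.+ w ℕ.* u  ≡⟨ ℕ.*-suc w u ⟨
  w ℕ.* suc u    ≤⟨ ℕ.*-monoʳ-≤ w u<v ⟩
  w ℕ.* v        ∎
  where
  open ℕ.≤-Reasoning
  u<w*u : u ℕ.< w ℕ.* u
  u<w*u = subst (u ℕ.<_) (ℕ.*-comm u w) (ℕ.m<m*n u w {{ℕ.>-nonZero 0<u}} 2≤w)

<-+*ℤ : ∀ {c x y} → 0ℤ < c → 0ℤ < x → 0ℤ < y → y < c + x * y
<-+*ℤ (+<+ {n = c} 0<c) (+<+ {n = x} 0<x) (+<+ {n = y} _) =
  subst (λ t → + y < + c + t) (pos-* x y) (+<+ (<-+* 0<c 0<x))

<-shift : ∀ a u m → a + u < m → a < - u + m
<-shift a u m a+u<m = subst (_< - u + m) (cancel a u) (+-monoʳ-< (- u) a+u<m)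
  where cancel : ∀ a u → - u + (a + u) ≡ a
        cancel = solve-∀

return-dominance : ∀ {u v w} → 0ℤ < u → u < v → + 2 ≤ w → v < - u + w * v × w < - u + w * v
return-dominance (+<+ {n = u} 0<u) (+<+ {n = v} u<v) (+≤+ {n = w} 2≤w) =
  <-shift (+ v) (+ u) (+ w * + v) (below-product (v+u<w*v u<v 2≤w)) ,
  <-shift (+ w) (+ u) (+ w * + v) (below-product (w+u<w*v 0<u u<v 2≤w))
  where below-product : ∀ {a} → a ℕ.< w ℕ.* v → + a < + w * + v
        below-product a<wv = subst (+ _ <_) (pos-* w v) (+<+ a<wv)

two≤∣∣-mono : ∀ {y z} → 0ℤ < y → + 2 ≤ + ∣ y ∣ → y < z → + 2 ≤ + ∣ z ∣
two≤∣∣-mono (+<+ _) (+≤+ 2≤y) (+<+ y<z) = +≤+ (ℕ.≤-trans 2≤y (ℕ.<⇒≤ y<z))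

two≤pos : ∀ {w} → 0ℤ < w → + 2 ≤ + ∣ w ∣ → + 2 ≤ w
two≤pos (+<+ _) 2≤w = 2≤w

-- (2) Paths and acyclicity of relations

Acyclicᴿ : {A : Set} → (A → A → Set) → Set
Acyclicᴿ R = ∀ x → ¬ TransClosure R x x

Within : {A : Set} → (A → Set) → (A → A → Set) → A → A → Set
Within P R x y = P x × P y × R x y

mapPath : ∀ {A B : Set} {R : A → A → Set} {R' : B → B → Set} (f : A → B) →
          (∀ {x y} → R x y → R' (f x) (f y)) →
          ∀ {x y} → TransClosure R x y → TransClosure R' (f x) (f y)
mapPath f edge [ xy ]     = [ edge xy ]
mapPath f edge (xy ∷ yz) = edge xy ∷ mapPath f edge yz

acyclic-⊆ : ∀ {A : Set} {R R' : A → A → Set} →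
            (∀ {x y} → R x y → R' x y) → Acyclicᴿ R' → Acyclicᴿ R
acyclic-⊆ sub acyclic x cycle = acyclic x (mapPath id sub cycle)

acyclic-within : ∀ {A : Set} {P S : A → Set} {R : A → A → Set} →
                 Acyclicᴿ (Within P R) → Acyclicᴿ (Within P (Within S R))
acyclic-within = acyclic-⊆ (λ (Px , Py , _ , _ , xy) → Px , Py , xy)

reversePath : ∀ {A : Set} {R : A → A → Set} {x y} → TransClosure R x y → TransClosure (flip R) y x
reversePath [ xy ]     = [ xy ]
reversePath (xy ∷ yz) = reversePath yz ∷ʳ xy

acyclic-flip : ∀ {A : Set} {R : A → A → Set} → Acyclicᴿ R → Acyclicᴿ (flip R)
acyclic-flip acyclic x cycle = acyclic x (reversePath cycle)

acyclic-empty : ∀ {A : Set} {R : A → A → Set} → (∀ {x y} → ¬ R x y) → Acyclicᴿ R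
acyclic-empty none x [ xx ]    = none xx
acyclic-empty none x (xy ∷ _) = none xy

-- A path entering L never leaves it, so a
-- cycle lies entirely in L or entirely in U; hence R is acyclic if both layers are.
module Layers {A : Set} {R : A → A → Set} (L U : A → Set)
              (layer  : ∀ {x y} → R x y → L x ⊎ U x)
              (closed : ∀ {x y} → R x y → L x → L y) where

  stay-lower : ∀ {x y} → TransClosure R x y → L x → TransClosure (Within L R) x y × L y
  stay-lower [ xy ]     Lx = [ Lx , closed xy Lx , xy ] , closed xy Lx
  stay-lower (xy ∷ yz) Lx = Product.map₁ ((Lx , closed xy Lx , xy) ∷_) (stay-lower yz (closed xy Lx))

  start-layer : ∀ {x y} → TransClosure R x y → L x ⊎ U x
  start-layer [ xy ]    = layer xy
  start-layer (xy ∷ _) = layer xy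

  climb : ∀ {x y} → TransClosure R x y → U x → U y → TransClosure (Within U R) x y ⊎ L y
  climb [ xy ]     Ux Uy = inj₁ [ Ux , Uy , xy ]
  climb (xy ∷ yz) Ux Uz with start-layer yz
  ... | inj₁ Ly = inj₂ (proj₂ (stay-lower yz Ly))
  ... | inj₂ Uy = Sum.map₁ ((Ux , Uy , xy) ∷_) (climb yz Uy Uz)

  acyclic : Acyclicᴿ (Within L R) → Acyclicᴿ (Within U R) → Acyclicᴿ R
  acyclic acyclicL acyclicU x cycle with start-layer cycle
  ... | inj₁ Lx = acyclicL x (proj₁ (stay-lower cycle Lx))
  ... | inj₂ Ux with climb cycle Ux Ux
  ...   | inj₁ cycleU = acyclicU x cycleU
  ...   | inj₂ Lx     = acyclicL x (proj₁ (stay-lower cycle Lx))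

-- (3) Matrix mutation

-- Pointwise equality of matrices; without function extensionality this is the equality that
-- mutation respects.
_≈_ : Matrix n → Matrix n → Set
b ≈ c = ∀ i j → b i j ≡ c i j

transpose : Matrix n → Matrix n
transpose b i j = b j i

Arr : Matrix n → Fin n → Fin n → Set
Arr b i j = 0ℤ < b i j

mutate-row : ∀ k (b : Matrix n) j → mutate k b k j ≡ - b k j
mutate-row k b j with k ≟ k
... | yes _   = refl
... | no k≢k = ⊥-elim (k≢k refl)

mutate-col : ∀ k (b : Matrix n) i → mutate k b i k ≡ - b i k
mutate-col k b i with i ≟ k | k ≟ k
... | yes _ | _       = refl
... | no _  | yes _   = refl
... | no _  | no k≢k = ⊥-elim (k≢k refl)

mutate-off : ∀ k (b : Matrix n) {i j} → i ≢ k → j ≢ k →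
             mutate k b i j ≡ b i j + signedProduct (b i k) (b k j)
mutate-off k b {i} {j} i≢k j≢k with i ≟ k | j ≟ k
... | yes i≡k | _       = ⊥-elim (i≢k i≡k)
... | no _    | yes j≡k = ⊥-elim (j≢k j≡k)
... | no _    | no _    = cong (_+_ (b i j)) (mutation-increment (b i k) (b k j))

mutate-cong : ∀ {b c : Matrix n} k → b ≈ c → mutate k b ≈ mutate k c
mutate-cong k e i j rewrite e i j | e i k | e k j = refl

-- Mutation is an involution.  The case splits go through toSum so that the decision is not
-- abstracted inside the unfolded definition of mutate, keeping the row/column lemmas applicable.
mutate-involutive : ∀ k (b : Matrix n) → mutate k (mutate k b) ≈ b
mutate-involutive k b i j with toSum (i ≟ k) | toSum (j ≟ k)
... | inj₁ refl | _ =
  trans (mutate-row k (mutate k b) j) (trans (cong -_ (mutate-row k b j)) (neg-involutive (b k j)))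
... | inj₂ _ | inj₁ refl =
  trans (mutate-col k (mutate k b) i) (trans (cong -_ (mutate-col k b i)) (neg-involutive (b i k)))
... | inj₂ i≢k | inj₂ j≢k = begin
  mutate k b' i j                                ≡⟨ mutate-off k b' i≢k j≢k ⟩
  b' i j + signedProduct (b' i k) (b' k j)      ≡⟨ cong₂ (λ u v → b' i j + signedProduct u v)
                                                      (mutate-col k b i) (mutate-row k b j) ⟩
  b' i j + signedProduct (- b i k) (- b k j)    ≡⟨ cong₂ _+_ (mutate-off k b i≢k j≢k)
                                                      (signedProduct-neg (b i k) (b k j)) ⟩
  b i j + s + - s                                ≡⟨ cancel (b i j) s ⟩
  b i j                                          ∎
  where
  open ≡-Reasoning
  b' : Matrix _
  b' = mutate k b
  s : ℤ
  s = signedProduct (b i k) (b k j)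
  cancel : ∀ a s → a + s + - s ≡ a
  cancel = solve-∀

mutate-transpose : ∀ k (b : Matrix n) → transpose (mutate k b) ≈ mutate k (transpose b)
mutate-transpose k b i j with toSum (i ≟ k) | toSum (j ≟ k)
... | inj₁ refl | inj₁ refl = refl
... | inj₁ refl | inj₂ _    = trans (mutate-col k b j) (sym (mutate-row k (transpose b) j))
... | inj₂ _    | inj₁ refl = trans (mutate-row k b i) (sym (mutate-col k (transpose b) i))
... | inj₂ i≢k  | inj₂ j≢k  = begin
  mutate k b j i                               ≡⟨ mutate-off k b j≢k i≢k ⟩
  b j i + signedProduct (b j k) (b k i)       ≡⟨ cong (_+_ (b j i)) (signedProduct-comm (b j k) (b k i)) ⟩
  b j i + signedProduct (b k i) (b j k)       ≡⟨ mutate-off k (transpose b) i≢k j≢k ⟨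
  mutate k (transpose b) i j                   ∎
  where open ≡-Reasoning

mutate-skew : ∀ k → SkewSymmetric b → SkewSymmetric (mutate k b)
mutate-skew {b = b} k skew i j with toSum (i ≟ k) | toSum (j ≟ k)
... | inj₁ refl | _ =
  trans (mutate-row k b j) (cong -_ (trans (skew k j) (sym (mutate-col k b j))))
... | inj₂ _ | inj₁ refl =
  trans (mutate-col k b i) (cong -_ (trans (skew i k) (sym (mutate-row k b i))))
... | inj₂ i≢k | inj₂ j≢k = begin
  mutate k b i j                                   ≡⟨ mutate-off k b i≢k j≢k ⟩
  b i j + signedProduct (b i k) (b k j)           ≡⟨ negate-sum (b i j) _ ⟩
  - (- b i j + - signedProduct (b i k) (b k j))   ≡⟨ cong₂ (λ u v → - (u + v)) (sym (skew j i)) reflected ⟩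
  - (b j i + signedProduct (b j k) (b k i))       ≡⟨ cong -_ (mutate-off k b j≢k i≢k) ⟨
  - mutate k b j i                                 ∎
  where
  open ≡-Reasoning
  negate-sum : ∀ a s → a + s ≡ - (- a + - s)
  negate-sum = solve-∀
  reflected : - signedProduct (b i k) (b k j) ≡ signedProduct (b j k) (b k i)
  reflected = begin
    - signedProduct (b i k) (b k j)       ≡⟨ signedProduct-neg (b i k) (b k j) ⟨
    signedProduct (- b i k) (- b k j)     ≡⟨ cong₂ signedProduct (skew k i) (skew j k) ⟨
    signedProduct (b k i) (b j k)         ≡⟨ signedProduct-comm (b k i) (b j k) ⟩
    signedProduct (b j k) (b k i)         ∎

module Skew {b : Matrix n} (skew : SkewSymmetric b) where

  neg-flip : ∀ i j → - b j i ≡ b i j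
  neg-flip i j = trans (cong -_ (skew j i)) (neg-involutive (b i j))

  no-loop : ¬ Arr b i i
  no-loop {i} = <-irrefl (sym (self-negating⇒0 (b i i) (skew i i)))

  reverse-negative : Arr b i j → b j i < 0ℤ
  reverse-negative {i} {j} ij = 0<-z⇒z<0 (subst (0ℤ <_) (sym (neg-flip i j)) ij)

  no-2-cycle : Arr b i j → ¬ Arr b j i
  no-2-cycle ij ji = <-asym ji (reverse-negative ij)

  arrow⇒≢ : Arr b i j → i ≢ j
  arrow⇒≢ ii refl = no-loop ii

  joined : TwoComplete b → i ≢ j → Arr b i j ⊎ Arr b j i
  joined {i} {j} complete i≢j with large⇒pos⊎neg (b i j) (complete i j i≢j)
  ... | inj₁ ij = inj₁ ij
  ... | inj₂ ji = inj₂ (subst (0ℤ <_) (neg-flip j i) (z<0⇒0<-z ji))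

-- (4) Forks

Out In : Matrix n → Fin n → Fin n → Set
Out b r x = Arr b r x
In  b r x = Arr b x r

record Fork (b : Matrix n) (r : Fin n) : Set where
  field
    skew      : SkewSymmetric b
    complete  : TwoComplete b
    acyclic⁺  : Acyclicᴿ (Within (Out b r) (Arr b))
    acyclic⁻  : Acyclicᴿ (Within (In b r) (Arr b))
    dominated : Arr b i r → Arr b r j → b i r < b j i × b r j < b j i

skew-resp : ∀ {b c : Matrix n} → b ≈ c → SkewSymmetric c → SkewSymmetric b
skew-resp e skew i j = trans (e i j) (trans (skew i j) (cong -_ (sym (e j i))))

complete-resp : ∀ {b c : Matrix n} → b ≈ c → TwoComplete c → TwoComplete b
complete-resp e complete i j i≢j = subst (λ w → + 2 ≤ + ∣ w ∣) (sym (e i j)) (complete i j i≢j)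

arrow-resp : ∀ {b c : Matrix n} → b ≈ c → Arr b i j → Arr c i j
arrow-resp {i = i} {j = j} e = subst (0ℤ <_) (e i j)

Fork-resp : ∀ {b c : Matrix n} → b ≈ c → Fork c r → Fork b r
Fork-resp {r = r} {b = b} {c = c} e F = record
  { skew      = skew-resp e skew
  ; complete  = complete-resp e complete
  ; acyclic⁺  = acyclic-⊆ out-resp acyclic⁺
  ; acyclic⁻  = acyclic-⊆ in-resp acyclic⁻
  ; dominated = dominated-b
  }
  where
  open Fork F
  out-resp : ∀ {x y} → Within (Out b r) (Arr b) x y → Within (Out c r) (Arr c) x y
  out-resp (rx , ry , xy) = arrow-resp e rx , arrow-resp e ry , arrow-resp e xy
  in-resp : ∀ {x y} → Within (In b r) (Arr b) x y → Within (In c r) (Arr c) x y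
  in-resp (xr , yr , xy) = arrow-resp e xr , arrow-resp e yr , arrow-resp e xy
  dominated-b : Arr b i r → Arr b r j → b i r < b j i × b r j < b j i
  dominated-b {i} {j} ir rj =
    Product.map (subst₂ _<_ (sym (e i r)) (sym (e j i))) (subst₂ _<_ (sym (e r j)) (sym (e j i)))
                (dominated (arrow-resp e ir) (arrow-resp e rj))

Fork-transpose : Fork b r → Fork (transpose b) r
Fork-transpose {b = b} {r} F = record
  { skew      = λ i j → skew j i
  ; complete  = λ i j i≢j → complete j i (≢-sym i≢j)
  ; acyclic⁺  = acyclic-⊆ out-flip (acyclic-flip acyclic⁻)
  ; acyclic⁻  = acyclic-⊆ in-flip (acyclic-flip acyclic⁺)
  ; dominated = λ ri jr → Product.swap (dominated jr ri)
  }
  where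
  open Fork F
  out-flip : ∀ {x y} → Within (Out (transpose b) r) (Arr (transpose b)) x y →
             flip (Within (In b r) (Arr b)) x y
  out-flip (rx , ry , xy) = ry , rx , xy
  in-flip : ∀ {x y} → Within (In (transpose b) r) (Arr (transpose b)) x y →
            flip (Within (Out b r) (Arr b)) x y
  in-flip (xr , yr , xy) = yr , xr , xy

SourceOrSinkOn : Matrix n → (Fin n → Set) → Fin n → Set
SourceOrSinkOn b S v = (∀ {x} → S x → 0ℤ ≤ b v x) ⊎ (∀ {x} → S x → b v x ≤ 0ℤ)

module ForkFacts {b : Matrix n} {r : Fin n} (F : Fork b r) where
  open Fork F
  open Skew skew

  neighbour : x ≢ r → Out b r x ⊎ In b r x
  neighbour x≢r = joined complete (≢-sym x≢r)

  back-arrow : Arr b i r → Arr b r j → Arr b j i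
  back-arrow ir rj = <-trans ir (proj₁ (dominated ir rj))

  private
    no-loop-at-r : ∀ {S : Fin n → Set} {x y} → ¬ Within (_≡ r) (Within S (Arr b)) x y
    no-loop-at-r (refl , refl , _ , _ , rr) = no-loop rr

  -- A full subquiver avoiding r is acyclic: in-neighbours of r lie below out-neighbours.
  acyclic-avoiding : (S : Fin n → Set) → ¬ S r → Acyclicᴿ (Within S (Arr b))
  acyclic-avoiding S ¬Sr =
    Layers.acyclic (In b r) (Out b r) layer closed (acyclic-within acyclic⁻) (acyclic-within acyclic⁺)
    where
    not-r : ∀ {x} → S x → x ≢ r
    not-r Sx refl = ¬Sr Sx
    layer : ∀ {x y} → Within S (Arr b) x y → In b r x ⊎ Out b r x
    layer (Sx , _ , _) = Sum.swap (neighbour (not-r Sx))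
    closed : ∀ {x y} → Within S (Arr b) x y → In b r x → In b r y
    closed (_ , Sy , xy) xr with neighbour (not-r Sy)
    ... | inj₁ ry = ⊥-elim (no-2-cycle xy (back-arrow xr ry))
    ... | inj₂ yr = yr

  -- Without in-neighbours of r, the vertex r lies below the out-neighbours.
  acyclic-without-in : (S : Fin n → Set) → (∀ {x} → S x → ¬ In b r x) → Acyclicᴿ (Within S (Arr b))
  acyclic-without-in S no-in =
    Layers.acyclic (Out b r) (_≡ r) layer closed (acyclic-within acyclic⁺) (acyclic-empty no-loop-at-r)
    where
    layer : ∀ {x y} → Within S (Arr b) x y → Out b r x ⊎ x ≡ r
    layer {x} (Sx , _ , _) with x ≟ r
    ... | yes x≡r = inj₂ x≡r
    ... | no x≢r  = inj₁ (Sum.[ id , (λ xr → ⊥-elim (no-in Sx xr)) ] (neighbour x≢r))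
    closed : ∀ {x y} → Within S (Arr b) x y → Out b r x → Out b r y
    closed {y = y} (_ , Sy , xy) rx with y ≟ r
    ... | yes refl = ⊥-elim (no-2-cycle rx xy)
    ... | no y≢r   = Sum.[ id , (λ yr → ⊥-elim (no-in Sy yr)) ] (neighbour y≢r)

  -- Without out-neighbours of r, the vertex r is a sink below the in-neighbours.
  acyclic-without-out : (S : Fin n → Set) → (∀ {x} → S x → ¬ Out b r x) → Acyclicᴿ (Within S (Arr b))
  acyclic-without-out S no-out =
    Layers.acyclic (_≡ r) (In b r) layer closed (acyclic-empty no-loop-at-r) (acyclic-within acyclic⁻)
    where
    layer : ∀ {x y} → Within S (Arr b) x y → x ≡ r ⊎ In b r x
    layer {x} (Sx , _ , _) with x ≟ r
    ... | yes x≡r = inj₁ x≡r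
    ... | no x≢r  = inj₂ (Sum.[ (λ rx → ⊥-elim (no-out Sx rx)) , id ] (neighbour x≢r))
    closed : ∀ {x y} → Within S (Arr b) x y → x ≡ r → y ≡ r
    closed (_ , Sy , ry) refl = ⊥-elim (no-out Sy ry)

  -- A source or sink v of the full subquiver on S forces one of the three cases above.
  acyclic-with-source-or-sink : (S : Fin n → Set) (v : Fin n) → SourceOrSinkOn b S v →
                                Acyclicᴿ (Within S (Arr b))
  acyclic-with-source-or-sink S v (inj₁ source) with v ≟ r
  ... | yes refl = acyclic-without-in S (λ Sx xr → ≤⇒≯ (source Sx) (reverse-negative xr))
  ... | no v≢r with neighbour v≢r
  ...   | inj₁ rv = acyclic-avoiding S (λ Sr → ≤⇒≯ (source Sr) (reverse-negative rv))
  ...   | inj₂ vr = acyclic-without-out S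
                      (λ Sx rx → ≤⇒≯ (source Sx) (reverse-negative (back-arrow vr rx)))
  acyclic-with-source-or-sink S v (inj₂ sink) with v ≟ r
  ... | yes refl = acyclic-without-out S (λ Sx rx → ≤⇒≯ (sink Sx) rx)
  ... | no v≢r with neighbour v≢r
  ...   | inj₁ rv = acyclic-without-in S (λ Sx xr → ≤⇒≯ (sink Sx) (back-arrow xr rv))
  ...   | inj₂ vr = acyclic-avoiding S (λ Sr → ≤⇒≯ (sink Sr) vr)

-- (5) Mutation creates forks

module Mutation {b : Matrix n} (skew : SkewSymmetric b) (k : Fin n) where
  open Skew skew

  c : Matrix n
  c = mutate k b

  c-row : ∀ j → c k j ≡ b j k
  c-row j = trans (mutate-row k b j) (neg-flip j k)

  c-col : ∀ i → c i k ≡ b k i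
  c-col i = trans (mutate-col k b i) (neg-flip k i)

  from-row : Arr c k j → Arr b j k
  from-row {j} = subst (0ℤ <_) (c-row j)

  from-col : Arr c i k → Arr b k i
  from-col {i} = subst (0ℤ <_) (c-col i)

  to-row : Arr b j k → Arr c k j
  to-row {j} = subst (0ℤ <_) (sym (c-row j))

  to-col : Arr b k i → Arr c i k
  to-col {i} = subst (0ℤ <_) (sym (c-col i))

  abs-row : ∀ j → ∣ c k j ∣ ≡ ∣ b k j ∣
  abs-row j = trans (cong ∣_∣ (mutate-row k b j)) (∣-i∣≡∣i∣ (b k j))

  abs-col : ∀ i → ∣ c i k ∣ ≡ ∣ b i k ∣
  abs-col i = trans (cong ∣_∣ (mutate-col k b i)) (∣-i∣≡∣i∣ (b i k))

  unchanged-in : Arr b i k → Arr b j k → c i j ≡ b i j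
  unchanged-in {i} {j} ik jk = begin
    c i j                                   ≡⟨ mutate-off k b (arrow⇒≢ ik) (arrow⇒≢ jk) ⟩
    b i j + signedProduct (b i k) (b k j)  ≡⟨ cong (_+_ (b i j)) mixed ⟩
    b i j + 0ℤ                              ≡⟨ +-identityʳ (b i j) ⟩
    b i j                                   ∎
    where
    open ≡-Reasoning
    mixed : signedProduct (b i k) (b k j) ≡ 0ℤ
    mixed = signedProduct-mixed (<⇒≤ ik) (<⇒≤ (reverse-negative jk))

  unchanged-out : Arr b k i → Arr b k j → c i j ≡ b i j
  unchanged-out {i} {j} ki kj = begin
    c i j                                   ≡⟨ mutate-off k b (≢-sym (arrow⇒≢ ki)) (≢-sym (arrow⇒≢ kj)) ⟩
    b i j + signedProduct (b i k) (b k j)  ≡⟨ cong (_+_ (b i j)) mixed ⟩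
    b i j + 0ℤ                              ≡⟨ +-identityʳ (b i j) ⟩
    b i j                                   ∎
    where
    open ≡-Reasoning
    mixed : signedProduct (b i k) (b k j) ≡ 0ℤ
    mixed = trans (signedProduct-comm (b i k) (b k j))
                  (signedProduct-mixed (<⇒≤ kj) (<⇒≤ (reverse-negative ki)))

  across : Arr b k i → Arr b j k → c j i ≡ b j i + b j k * b k i
  across {i} {j} ki jk =
    trans (mutate-off k b (arrow⇒≢ jk) (≢-sym (arrow⇒≢ ki))) (cong (_+_ (b j i)) (signedProduct-pos jk ki))

  neighbourhood-out : Within (Out c k) (Arr c) x y → Within (In b k) (Arr b) x y
  neighbourhood-out (kx , ky , xy) =
    from-row kx , from-row ky , subst (0ℤ <_) (unchanged-in (from-row kx) (from-row ky)) xy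

  neighbourhood-in : Within (In c k) (Arr c) x y → Within (Out b k) (Arr b) x y
  neighbourhood-in (xk , yk , xy) =
    from-col xk , from-col yk , subst (0ℤ <_) (unchanged-out (from-col xk) (from-col yk)) xy

  dominated-by-arrow : Arr c i k → Arr c k j → Arr b j i → c i k < c j i × c k j < c j i
  dominated-by-arrow {i} {j} ik kj ji =
    subst₂ _<_ (sym (c-col i)) (sym (across ki jk)) (<-+*ℤ ji jk ki) ,
    subst₂ _<_ (sym (c-row j)) (sym (across ki jk))
      (subst (λ t → b j k < b j i + t) (*-comm (b k i) (b j k)) (<-+*ℤ ji ki jk))
    where
    ki : Arr b k i
    ki = from-col ik
    jk : Arr b j k
    jk = from-row kj

  -- 2-completeness survives: the only entries that can become small are those j → i closing
  -- paths i → k → j of c, and these exceed the entries at k by dominance.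
  complete-c : TwoComplete b → (∀ {i j} → Arr c i k → Arr c k j → c i k < c j i × c k j < c j i) →
               TwoComplete c
  complete-c complete dominated i j i≢j with toSum (i ≟ k) | toSum (j ≟ k)
  ... | inj₁ refl | _         = subst (λ w → + 2 ≤ + w) (sym (abs-row j)) (complete k j i≢j)
  ... | inj₂ _    | inj₁ refl = subst (λ w → + 2 ≤ + w) (sym (abs-col i)) (complete i k i≢j)
  ... | inj₂ i≢k  | inj₂ j≢k  with joined complete i≢k | joined complete (≢-sym j≢k)
  ...   | inj₁ ik | inj₁ kj = two≤∣∣-mono jk′ large (proj₁ (dominated jk′ (to-row ik)))
    where
    jk′ : Arr c j k
    jk′ = to-col kj
    large : + 2 ≤ + ∣ c j k ∣
    large = subst (λ w → + 2 ≤ + w) (sym (abs-col j)) (complete j k j≢k)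
  ...   | inj₂ ki | inj₂ jk =
    subst (λ w → + 2 ≤ + w) (sym (trans (cong ∣_∣ (mutate-skew k skew i j)) (∣-i∣≡∣i∣ (c j i))))
      (two≤∣∣-mono ik′ large (proj₁ (dominated ik′ (to-row jk))))
    where
    ik′ : Arr c i k
    ik′ = to-col ki
    large : + 2 ≤ + ∣ c i k ∣
    large = subst (λ w → + 2 ≤ + w) (sym (abs-col i)) (complete i k i≢k)
  ...   | inj₁ ik | inj₂ jk = subst (λ w → + 2 ≤ + ∣ w ∣) (sym (unchanged-in ik jk)) (complete i j i≢j)
  ...   | inj₂ ki | inj₁ kj = subst (λ w → + 2 ≤ + ∣ w ∣) (sym (unchanged-out ki kj)) (complete i j i≢j)

fork-from-acyclic : SkewSymmetric b → TwoComplete b → Acyclicᴿ (Arr b) → ∀ k → Fork (mutate k b) k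
fork-from-acyclic {b = b} skew complete acyclic k = record
  { skew      = mutate-skew k skew
  ; complete  = complete-c complete dominated-c
  ; acyclic⁺  = acyclic-⊆ (λ w → proj₂ (proj₂ (neighbourhood-out w))) acyclic
  ; acyclic⁻  = acyclic-⊆ (λ w → proj₂ (proj₂ (neighbourhood-in w))) acyclic
  ; dominated = dominated-c
  }
  where
  open Skew skew
  open Mutation skew k
  -- A path i → k → j of c comes from j → k → i in b, which acyclicity closes by j → i.
  dominated-c : Arr c i k → Arr c k j → c i k < c j i × c k j < c j i
  dominated-c {i} {j} ik kj with j ≟ i
  ... | yes refl = ⊥-elim (no-2-cycle (from-col ik) (from-row kj))
  ... | no j≢i with joined complete j≢i
  ...   | inj₁ ji = dominated-by-arrow ik kj ji
  ...   | inj₂ ij = ⊥-elim (acyclic i (ij ∷ from-row kj ∷ [ from-col ik ]))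

fork-from-fork : Fork b r → Arr b r k → Fork (mutate k b) k
fork-from-fork {b = b} {r} {k} F rk = record
  { skew      = mutate-skew k skew
  ; complete  = complete-c complete dominated-c
  ; acyclic⁺  = acyclic-⊆ neighbourhood-out
                  (acyclic-without-in (In b k) (λ xk xr → no-2-cycle xk (back-arrow xr rk)))
  ; acyclic⁻  = acyclic-⊆ neighbourhood-in (acyclic-avoiding (Out b k) (no-2-cycle rk))
  ; dominated = dominated-c
  }
  where
  open Fork F
  open Skew skew
  open ForkFacts F
  open Mutation skew k

  -- The path i → k → r of c with i → r in b: the new arrows r → i come from r → k → i.
  through-return : Arr c i k → Arr c k r → Arr b i r → c i k < c r i × c k r < c r i
  through-return {i} ik kr ir =
    Product.map (subst₂ _<_ (sym (c-col i)) (sym entry)) (subst₂ _<_ (sym (c-row r)) (sym entry))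
      (return-dominance ir (proj₁ (dominated ir rk)) (two≤pos rk (complete r k (arrow⇒≢ rk))))
    where
    entry : c r i ≡ - b i r + b r k * b k i
    entry = trans (across (from-col ik) rk) (cong (_+ b r k * b k i) (skew r i))

  -- A path i → k → j of c between out-neighbours of r: b has j → i, or a cycle among them.
  among-out : Arr c i k → Arr c k j → Out b r i → Out b r j → c i k < c j i × c k j < c j i
  among-out {i} {j} ik kj ri rj with j ≟ i
  ... | yes refl = ⊥-elim (no-2-cycle (from-col ik) (from-row kj))
  ... | no j≢i with joined complete j≢i
  ...   | inj₁ ji = dominated-by-arrow ik kj ji
  ...   | inj₂ ij = ⊥-elim (acyclic⁺ j ((rj , rk , from-row kj) ∷ (rk , ri , from-col ik) ∷ [ ri , rj , ij ]))

  dominated-c : Arr c i k → Arr c k j → c i k < c j i × c k j < c j i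
  dominated-c {i} {j} ik kj with i ≟ r | j ≟ r
  ... | yes refl | _        = ⊥-elim (no-2-cycle rk (from-col ik))
  ... | no i≢r   | yes refl = Sum.[ dominated-by-arrow ik kj , through-return ik kj ] (neighbour i≢r)
  ... | no i≢r   | no j≢r   with neighbour i≢r | neighbour j≢r
  ...   | _       | inj₂ jr = ⊥-elim (no-2-cycle (from-row kj) (back-arrow jr rk))
  ...   | inj₂ ir | inj₁ rj = dominated-by-arrow ik kj (back-arrow ir rj)
  ...   | inj₁ ri | inj₁ rj = among-out ik kj ri rj

fork-from-fork-in : Fork b r → Arr b k r → Fork (mutate k b) k
fork-from-fork-in {b = b} {k = k} F kr =
  Fork-transpose (Fork-resp (mutate-transpose k b) (fork-from-fork (Fork-transpose F) kr))

-- (6) Fork chains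

-- A fork chain for b: b is 2-complete and acyclic, or b is a fork at some r whose mutation at
-- r again has a fork chain.  It records a mutation sequence without immediate repetitions.
data ForkChain {n : ℕ} : Matrix n → Set where
  acyclic : SkewSymmetric b → TwoComplete b → Acyclicᴿ (Arr b) → ForkChain b
  fork    : ∀ r → Fork b r → ForkChain (mutate r b) → ForkChain b

ForkChain-resp : ∀ {b c : Matrix n} → b ≈ c → ForkChain c → ForkChain b
ForkChain-resp e (acyclic skew complete acyclicc) =
  acyclic (skew-resp e skew) (complete-resp e complete) (acyclic-⊆ (arrow-resp e) acyclicc)
ForkChain-resp e (fork r F chain) = fork r (Fork-resp e F) (ForkChain-resp (mutate-cong r e) chain)

-- Every mutation of a quiver with a fork chain has one: mutating at the point of return
-- steps back along the chain, any other mutation creates a new fork.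
ForkChain-mutate : ForkChain b → ∀ k → ForkChain (mutate k b)
ForkChain-mutate {b = b} chain@(acyclic skew complete acyclicb) k =
  fork k (fork-from-acyclic skew complete acyclicb k) (ForkChain-resp (mutate-involutive k b) chain)
ForkChain-mutate {b = b} chain@(fork r F previous) k with k ≟ r
... | yes refl = previous
... | no k≢r   = fork k (Sum.[ fork-from-fork F , fork-from-fork-in F ] (ForkFacts.neighbour F k≢r))
                        (ForkChain-resp (mutate-involutive k b) chain)

ForkChain-mutateSeq : ∀ ks → ForkChain b → ForkChain (mutateSeq ks b)
ForkChain-mutateSeq List.[]       chain = chain
ForkChain-mutateSeq (k List.∷ ks) chain = ForkChain-mutateSeq ks (ForkChain-mutate chain k)

ForkChain-subquiver : ForkChain b → (S : Fin n → Set) (v : Fin n) → SourceOrSinkOn b S v →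
                      Acyclicᴿ (Within S (Arr b))
ForkChain-subquiver (acyclic _ _ acyclicb) S v _ = acyclic-⊆ (λ (_ , _ , xy) → xy) acyclicb
ForkChain-subquiver (fork r F _)           S v   = ForkFacts.acyclic-with-source-or-sink F S v

-- (7) The corollary

fromPath : Path b i j → TransClosure (Arr b) i j
fromPath (arrow ij)  = [ ij ]
fromPath (ij ◅ jk) = ij ∷ fromPath jk

toPath : TransClosure (Arr b) i j → Path b i j
toPath [ ij ]     = arrow ij
toPath (ij ∷ jk) = ij ◅ toPath jk

-- B' carries a fork chain since B does; the full subquiver on the image of f is acyclic by
-- ForkChain-subquiver.
corollary3p7 : (n : ℕ) (B : Matrix n) → SkewSymmetric B → TwoComplete B → Acyclic B →
    (B' : Matrix n) → MutationEquivalent B B' →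
    (m : ℕ) (f : Fin m → Fin n) → Injective _≡_ _≡_ f →
    HasSourceOrSink (restrict B' f) → Acyclic (restrict B' f)
corollary3p7 n B skew complete acyclicB B' (ks , B'≡) m f _ (v , sourceOrSink) a cycle =
  ForkChain-subquiver chain Image (f v) onImage (f a) (mapPath f embed (fromPath cycle))
  where
  chain : ForkChain B'
  chain = subst ForkChain B'≡
            (ForkChain-mutateSeq ks (acyclic skew complete (λ x p → acyclicB x (toPath p))))
  Image : Fin n → Set
  Image x = ∃[ a ] f a ≡ x
  embed : ∀ {a a'} → Arr (restrict B' f) a a' → Within Image (Arr B') (f a) (f a')
  embed aa' = (_ , refl) , (_ , refl) , aa'
  onImage : SourceOrSinkOn B' Image (f v)
  onImage = Sum.map (λ source → λ { (a , refl) → source a }) (λ sink → λ { (a , refl) → sink a })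
                    sourceOrSink
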